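{- Let $n\ge1$, $d$ a positive divisor of $n$, $C$ the cyclic shift $C(x_0,\dots,x_{n-1})=(x_1,\dots,x_{n-1},x_0)$ and $R$ the reversal $R(y_0,\dots,y_{n-1})=(y_{n-1},\dots,y_1,y_0)$ on $\mathbb{Z}_2^n$. Let $X=(-1,+1,\dots,+1)$, $A_{i,d}X=\prod_{j=0}^{n/d-1}C^{i+jd}X$ for $0\le i\le d-1$, and $\mathbb{G}_d(n)$ the subgroup generated by $\{A_{0,d}X,\dots,A_{d-1,d}X\}$. Then $\mathbb{G}_d(n)$ is an $S$-subgroup of the Schur ring $\mathfrak{S}(\mathbb{Z}_2^n,H_nC_n)$, i.e. it is a union of orbits of the group $H_nC_n$ generated by $R$ and $C$.
   Context: $\mathbb{Z}_2^n$ is the group of $\pm1$ sequences of length $n$ under coordinatewise multiplication. $H_n=\{1,R\}$, $C_n=\langle C\rangle$, and $\mathfrak{S}(\mathbb{Z}_2^n,G)$ is the Schur ring whose basic sets are the orbits of the coordinate-permutation group $G$; an $S$-subgroup is a subgroup that is a union of basic sets. -}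

module Defs where

open import Data.Nat using (ℕ; zero; suc; _+_; _*_)
open import Data.Nat.Divisibility using (_∣_)
open import Data.Bool using (Bool; true; false; _xor_)
open import Data.Fin using (Fin; toℕ)
open import Data.Vec using (Vec; []; _∷_; _∷ʳ_; replicate; zipWith; reverse; init; last)
open import Data.List using (List; []; _∷_)
open import Data.Product using (Σ)
open import Relation.Binary.PropositionalEquality using (_≡_)

-- ℤ₂ⁿ encoded as Vec Bool n : true ↔ -1, false ↔ +1; multiplication ↔ xor.
Z2^ : ℕ → Set
Z2^ n = Vec Bool n

_·_ : ∀ {n} → Z2^ n → Z2^ n → Z2^ n
_·_ = zipWith _xor_

one : ∀ {n} → Z2^ n
one = replicate _ false

Cshift : ∀ {n} → Z2^ n → Z2^ n
Cshift [] = []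
Cshift (x ∷ xs) = xs ∷ʳ x

Cinv : ∀ {n} → Z2^ n → Z2^ n
Cinv [] = []
Cinv (x ∷ xs) = last (x ∷ xs) ∷ init (x ∷ xs)

Rrev : ∀ {n} → Z2^ n → Z2^ n
Rrev = reverse

Cpow : ∀ {n} → ℕ → Z2^ n → Z2^ n
Cpow zero x = x
Cpow (suc k) x = Cshift (Cpow k x)

-- X = (-1,+1,...,+1)  (for n = 0 there is no such vector; we use the empty vector)
Xvec : ∀ n → Z2^ n
Xvec zero = []
Xvec (suc n) = true ∷ replicate n false

prodA : ∀ n (d i k : ℕ) → Z2^ n
prodA n d i zero = one
prodA n d i (suc k) = prodA n d i k · Cpow (i + k * d) (Xvec n)

A : ∀ n d → d ∣ n → ℕ → Z2^ n
A n d dvd i = prodA n d i (_∣_.quotient dvd)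

-- 𝔾_d(n): subgroup of ℤ₂ⁿ generated by {A_{0,d}X,...,A_{d-1,d}X}
-- (every element is its own inverse, so closure under identity and product suffices)
data InG (n d : ℕ) (dvd : d ∣ n) : Z2^ n → Set where
  g-one : InG n d dvd one
  g-gen : (i : Fin d) → InG n d dvd (A n d dvd (toℕ i))
  g-mul : ∀ {x y} → InG n d dvd x → InG n d dvd y → InG n d dvd (x · y)

-- the group H_n C_n = ⟨R, C⟩ acting on coordinates: elements are words in R, C, C⁻¹
data Gen : Set where
  genR genC genC⁻¹ : Gen

actGen : ∀ {n} → Gen → Z2^ n → Z2^ n
actGen genR = Rrev
actGen genC = Cshift
actGen genC⁻¹ = Cinv

act : ∀ {n} → List Gen → Z2^ n → Z2^ n
act [] x = x
act (g ∷ w) x = actGen g (act w x)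

SameOrbit : ∀ {n} → Z2^ n → Z2^ n → Set
SameOrbit x y = Σ (List Gen) (λ w → act w x ≡ y)

-- Both C and R act on ℤ₂ⁿ as group automorphisms, so 𝔾_d(n) is stable under them as soon as
-- the images of the generators A_{i,d}X lie in 𝔾_d(n). For C this holds because
-- C(A_{i,d}X) = A_{i+1,d}X and the index i only matters modulo d (as C^n = 1 and d ∣ n).
-- For R, reversal conjugates C into C⁻¹ and sends X to CX, which turns the factors
-- C^{jd}X of A_{0,d}X into C·C^{(n/d-j)d}X; reindexing j ↦ n/d-j gives R(A_{0,d}X) = C(A_{0,d}X),
-- and R(A_{i,d}X) = R C^i (A_{0,d}X) = C^{n-i} R(A_{0,d}X).
module Submission where

open import Defs
open import Data.Nat using (ℕ; _≤_)
open import Data.Nat.Divisibility using (_∣_)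

open import Data.Nat using (zero; suc; pred; _+_; _*_; _∸_; _<_; NonZero; >-nonZero)
open import Data.Nat.Properties
  using (+-assoc; +-identityʳ; *-distribʳ-∸; *-monoˡ-≤; +-∸-assoc; m∸n+n≡m; ≤-refl; ≤-trans; <⇒≤; m<n⇒m<1+n)
open import Data.Nat.Divisibility using (∣⇒≤)
open import Data.Nat.DivMod using (_%_; _/_; m≡m%n+[m/n]*n; m%n<n)
open import Data.Bool using (false; _xor_)
open import Data.Bool.Properties using (xor-assoc; xor-comm; xor-identityˡ; xor-same)
open import Data.Fin using (Fin; toℕ; fromℕ<)
open import Data.Fin.Properties using (toℕ<n; toℕ-fromℕ<)
open import Data.Vec using (Vec; []; _∷_; _∷ʳ_; replicate; reverse; init; last; toList)
open import Data.Vec.Properties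
  using (zipWith-assoc; zipWith-comm; zipWith-identityˡ; reverse-∷; init-∷ʳ; last-∷ʳ;
         toList-∷ʳ; toList-injective; length-toList)
open import Data.Vec.Relation.Binary.Equality.Cast using (cast-is-id)
open import Data.List as List using (List; _++_; [_])
open import Data.List.Properties using (++-assoc; ++-identityʳ)
open import Data.Product using (_,_)
open import Relation.Binary.PropositionalEquality using (_≡_; refl; sym; trans; cong; cong₂; subst; module ≡-Reasoning)

·-assoc : ∀ {n} (x y z : Z2^ n) → (x · y) · z ≡ x · (y · z)
·-assoc = zipWith-assoc xor-assoc

·-comm : ∀ {n} (x y : Z2^ n) → x · y ≡ y · x
·-comm = zipWith-comm xor-comm

·-identityˡ : ∀ {n} (x : Z2^ n) → one · x ≡ x
·-identityˡ = zipWith-identityˡ xor-identityˡ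

·-identityʳ : ∀ {n} (x : Z2^ n) → x · one ≡ x
·-identityʳ x = trans (·-comm x one) (·-identityˡ x)

·-self : ∀ {n} (x : Z2^ n) → x · x ≡ one
·-self []      = refl
·-self (a ∷ x) = cong₂ _∷_ (xor-same a) (·-self x)

·-cancelˡ : ∀ {n} (x : Z2^ n) {y z} → x · y ≡ x · z → y ≡ z
·-cancelˡ x {y} {z} eq = begin
  y             ≡⟨ sym (·-identityˡ y) ⟩
  one · y       ≡⟨ cong (_· y) (sym (·-self x)) ⟩
  (x · x) · y   ≡⟨ ·-assoc x x y ⟩
  x · (x · y)   ≡⟨ cong (x ·_) eq ⟩
  x · (x · z)   ≡⟨ sym (·-assoc x x z) ⟩
  (x · x) · z   ≡⟨ cong (_· z) (·-self x) ⟩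
  one · z       ≡⟨ ·-identityˡ z ⟩
  z             ∎
  where open ≡-Reasoning

·-∷ʳ : ∀ {n} (x y : Z2^ n) a b → (x ∷ʳ a) · (y ∷ʳ b) ≡ (x · y) ∷ʳ (a xor b)
·-∷ʳ []      []      a b = refl
·-∷ʳ (c ∷ x) (e ∷ y) a b = cong ((c xor e) ∷_) (·-∷ʳ x y a b)

replicate-∷ʳ : ∀ {A : Set} n (a : A) → replicate n a ∷ʳ a ≡ replicate (suc n) a
replicate-∷ʳ zero    a = refl
replicate-∷ʳ (suc n) a = cong (a ∷_) (replicate-∷ʳ n a)

reverse-replicate : ∀ {A : Set} n (a : A) → reverse (replicate n a) ≡ replicate n a
reverse-replicate zero    a = refl
reverse-replicate (suc n) a = begin
  reverse (a ∷ replicate n a)   ≡⟨ reverse-∷ a (replicate n a) ⟩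
  reverse (replicate n a) ∷ʳ a  ≡⟨ cong (_∷ʳ a) (reverse-replicate n a) ⟩
  replicate n a ∷ʳ a            ≡⟨ replicate-∷ʳ n a ⟩
  replicate (suc n) a           ∎
  where open ≡-Reasoning

reverse-∷ʳ : ∀ {A : Set} {n} (xs : Vec A n) x → reverse (xs ∷ʳ x) ≡ x ∷ reverse xs
reverse-∷ʳ []       x = refl
reverse-∷ʳ (y ∷ xs) x = begin
  reverse (y ∷ (xs ∷ʳ x))   ≡⟨ reverse-∷ y (xs ∷ʳ x) ⟩
  reverse (xs ∷ʳ x) ∷ʳ y    ≡⟨ cong (_∷ʳ y) (reverse-∷ʳ xs x) ⟩
  x ∷ (reverse xs ∷ʳ y)     ≡⟨ cong (x ∷_) (sym (reverse-∷ y xs)) ⟩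
  x ∷ reverse (y ∷ xs)      ∎
  where open ≡-Reasoning

record IsEndomorphism {n} (f : Z2^ n → Z2^ n) : Set where
  field
    ·-homo   : ∀ x y → f (x · y) ≡ f x · f y
    one-homo : f one ≡ one

open IsEndomorphism

Cshift-isEndomorphism : ∀ {n} → IsEndomorphism (Cshift {n})
Cshift-isEndomorphism = record { ·-homo = homo ; one-homo = fixes-one _ }
  where
  fixes-one : ∀ n → Cshift (one {n}) ≡ one
  fixes-one zero    = refl
  fixes-one (suc n) = replicate-∷ʳ n false
  homo : ∀ {n} (x y : Z2^ n) → Cshift (x · y) ≡ Cshift x · Cshift y
  homo []      []      = refl
  homo (a ∷ x) (b ∷ y) = sym (·-∷ʳ x y a b)

Cpow-isEndomorphism : ∀ {n} k → IsEndomorphism (Cpow {n} k)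
Cpow-isEndomorphism zero    = record { ·-homo = λ _ _ → refl ; one-homo = refl }
Cpow-isEndomorphism (suc k) = record
  { ·-homo   = λ x y → trans (cong Cshift (·-homo (Cpow-isEndomorphism k) x y))
                             (·-homo Cshift-isEndomorphism (Cpow k x) (Cpow k y))
  ; one-homo = trans (cong Cshift (one-homo (Cpow-isEndomorphism k)))
                     (one-homo Cshift-isEndomorphism)
  }

Rrev-isEndomorphism : ∀ {n} → IsEndomorphism (Rrev {n})
Rrev-isEndomorphism = record { ·-homo = homo ; one-homo = reverse-replicate _ false }
  where
  homo : ∀ {n} (x y : Z2^ n) → Rrev (x · y) ≡ Rrev x · Rrev y
  homo []      []      = refl
  homo (a ∷ x) (b ∷ y) = begin
    reverse ((a xor b) ∷ (x · y))           ≡⟨ reverse-∷ (a xor b) (x · y) ⟩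
    reverse (x · y) ∷ʳ (a xor b)            ≡⟨ cong (_∷ʳ (a xor b)) (homo x y) ⟩
    (reverse x · reverse y) ∷ʳ (a xor b)    ≡⟨ sym (·-∷ʳ (reverse x) (reverse y) a b) ⟩
    (reverse x ∷ʳ a) · (reverse y ∷ʳ b)     ≡⟨ sym (cong₂ _·_ (reverse-∷ a x) (reverse-∷ b y)) ⟩
    reverse (a ∷ x) · reverse (b ∷ y)       ∎
    where open ≡-Reasoning

∏ : ∀ {n} → (ℕ → Z2^ n) → ℕ → Z2^ n
∏ f zero    = one
∏ f (suc k) = ∏ f k · f k

prodA-∏ : ∀ n d i k → prodA n d i k ≡ ∏ (λ j → Cpow (i + j * d) (Xvec n)) k
prodA-∏ n d i zero    = refl
prodA-∏ n d i (suc k) = cong (_· Cpow (i + k * d) (Xvec n)) (prodA-∏ n d i k)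

∏-cong : ∀ {n} {f g : ℕ → Z2^ n} k → (∀ j → j < k → f j ≡ g j) → ∏ f k ≡ ∏ g k
∏-cong zero    f≗g = refl
∏-cong (suc k) f≗g = cong₂ _·_ (∏-cong k (λ j j<k → f≗g j (m<n⇒m<1+n j<k))) (f≗g k ≤-refl)

∏-homo : ∀ {n} {g : Z2^ n → Z2^ n} → IsEndomorphism g →
         ∀ (f : ℕ → Z2^ n) k → g (∏ f k) ≡ ∏ (λ j → g (f j)) k
∏-homo g-endo f zero    = one-homo g-endo
∏-homo g-endo f (suc k) = trans (·-homo g-endo (∏ f k) (f k)) (cong (_· _) (∏-homo g-endo f k))

∏-unfoldˡ : ∀ {n} (f : ℕ → Z2^ n) k → ∏ f (suc k) ≡ f 0 · ∏ (λ j → f (suc j)) k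
∏-unfoldˡ f zero    = trans (·-identityˡ (f 0)) (sym (·-identityʳ (f 0)))
∏-unfoldˡ f (suc k) = trans (cong (_· f (suc k)) (∏-unfoldˡ f k)) (·-assoc _ _ _)

∏-reverse : ∀ {n} (f : ℕ → Z2^ n) k → ∏ f k ≡ ∏ (λ j → f (k ∸ suc j)) k
∏-reverse f zero    = refl
∏-reverse f (suc k) = begin
  ∏ f k · f k                            ≡⟨ cong (_· f k) (∏-reverse f k) ⟩
  ∏ (λ j → f (k ∸ suc j)) k · f k        ≡⟨ ·-comm _ (f k) ⟩
  f k · ∏ (λ j → f (k ∸ suc j)) k        ≡⟨ sym (∏-unfoldˡ (λ j → f (suc k ∸ suc j)) k) ⟩
  ∏ (λ j → f (suc k ∸ suc j)) (suc k)    ∎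
  where open ≡-Reasoning

∏-shift-periodic : ∀ {n} (f : ℕ → Z2^ n) k → f k ≡ f 0 → ∏ (λ j → f (suc j)) k ≡ ∏ f k
∏-shift-periodic f k fk≡f0 = ·-cancelˡ (f 0) (begin
  f 0 · ∏ (λ j → f (suc j)) k   ≡⟨ sym (∏-unfoldˡ f k) ⟩
  ∏ f k · f k                   ≡⟨ cong (∏ f k ·_) fk≡f0 ⟩
  ∏ f k · f 0                   ≡⟨ ·-comm (∏ f k) (f 0) ⟩
  f 0 · ∏ f k                   ∎)
  where open ≡-Reasoning

-- C has order n

Cpow-+ : ∀ {n} a b (v : Z2^ n) → Cpow (a + b) v ≡ Cpow a (Cpow b v)
Cpow-+ zero    b v = refl
Cpow-+ (suc a) b v = cong Cshift (Cpow-+ a b v)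

Cpow-suc : ∀ {n} k (v : Z2^ n) → Cpow (suc k) v ≡ Cpow k (Cshift v)
Cpow-suc zero    v = refl
Cpow-suc (suc k) v = cong Cshift (Cpow-suc k v)

rotate : ∀ {A : Set} → ℕ → List A → List A
rotate zero    xs               = xs
rotate (suc k) List.[]          = List.[]
rotate (suc k) (x List.∷ xs)    = rotate k (xs ++ [ x ])

rotate-++ : ∀ {A : Set} (xs ys : List A) → rotate (List.length xs) (xs ++ ys) ≡ ys ++ xs
rotate-++ List.[]       ys = sym (++-identityʳ ys)
rotate-++ (x List.∷ xs) ys = begin
  rotate (List.length xs) ((xs ++ ys) ++ [ x ])   ≡⟨ cong (rotate (List.length xs)) (++-assoc xs ys [ x ]) ⟩
  rotate (List.length xs) (xs ++ (ys ++ [ x ]))   ≡⟨ rotate-++ xs (ys ++ [ x ]) ⟩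
  (ys ++ [ x ]) ++ xs                             ≡⟨ ++-assoc ys [ x ] xs ⟩
  ys ++ x List.∷ xs                               ∎
  where open ≡-Reasoning

toList-Cpow : ∀ {n} k (v : Z2^ n) → toList (Cpow k v) ≡ rotate k (toList v)
toList-Cpow zero    v        = refl
toList-Cpow (suc k) []       = toList-empty (Cpow (suc k) [])
  where
  toList-empty : (w : Z2^ 0) → toList w ≡ List.[]
  toList-empty [] = refl
toList-Cpow (suc k) (x ∷ xs) = begin
  toList (Cpow (suc k) (x ∷ xs))   ≡⟨ cong toList (Cpow-suc k (x ∷ xs)) ⟩
  toList (Cpow k (xs ∷ʳ x))        ≡⟨ toList-Cpow k (xs ∷ʳ x) ⟩
  rotate k (toList (xs ∷ʳ x))      ≡⟨ cong (rotate k) (toList-∷ʳ x xs) ⟩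
  rotate k (toList xs ++ [ x ])    ∎
  where open ≡-Reasoning

Cpow-order : ∀ {n} (v : Z2^ n) → Cpow n v ≡ v
Cpow-order {n} v = trans (sym (cast-is-id refl (Cpow n v))) (toList-injective refl (Cpow n v) v (begin
  toList (Cpow n v)                                     ≡⟨ toList-Cpow n v ⟩
  rotate n (toList v)                                   ≡⟨ cong (λ k → rotate k (toList v)) (sym (length-toList v)) ⟩
  rotate (List.length (toList v)) (toList v)            ≡⟨ cong (rotate (List.length (toList v))) (sym (++-identityʳ (toList v))) ⟩
  rotate (List.length (toList v)) (toList v ++ List.[]) ≡⟨ rotate-++ (toList v) List.[] ⟩
  toList v                                              ∎))
  where open ≡-Reasoning

Cinv≡Cpow : ∀ {n} (v : Z2^ n) → Cinv v ≡ Cpow (pred n) v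
Cinv≡Cpow []                 = refl
Cinv≡Cpow {suc m} v = begin
  Cinv v                          ≡⟨ cong Cinv (sym (Cpow-order v)) ⟩
  Cinv (Cshift (Cpow m v))        ≡⟨ Cinv-Cshift (Cpow m v) ⟩
  Cpow m v                        ∎
  where
  open ≡-Reasoning
  Cinv-Cshift : ∀ {n} (w : Z2^ n) → Cinv (Cshift w) ≡ w
  Cinv-Cshift []       = refl
  Cinv-Cshift (y ∷ ys) = trans (Cinv-∷ (ys ∷ʳ y)) (cong₂ _∷_ (last-∷ʳ y ys) (init-∷ʳ y ys))
    where
    Cinv-∷ : ∀ {n} (w : Z2^ (suc n)) → Cinv w ≡ last w ∷ init w
    Cinv-∷ (z ∷ zs) = refl

-- Reversal conjugates C into C⁻¹

Cshift-Rrev-Cshift : ∀ {n} (v : Z2^ n) → Cshift (Rrev (Cshift v)) ≡ Rrev v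
Cshift-Rrev-Cshift []       = refl
Cshift-Rrev-Cshift (x ∷ xs) = begin
  Cshift (reverse (xs ∷ʳ x))   ≡⟨ cong Cshift (reverse-∷ʳ xs x) ⟩
  reverse xs ∷ʳ x              ≡⟨ sym (reverse-∷ x xs) ⟩
  reverse (x ∷ xs)             ∎
  where open ≡-Reasoning

Cpow-Rrev-Cpow : ∀ {n} k (v : Z2^ n) → Cpow k (Rrev (Cpow k v)) ≡ Rrev v
Cpow-Rrev-Cpow zero    v = refl
Cpow-Rrev-Cpow (suc k) v = begin
  Cpow (suc k) (Rrev (Cshift (Cpow k v)))     ≡⟨ Cpow-suc k _ ⟩
  Cpow k (Cshift (Rrev (Cshift (Cpow k v))))  ≡⟨ cong (Cpow k) (Cshift-Rrev-Cshift (Cpow k v)) ⟩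
  Cpow k (Rrev (Cpow k v))                    ≡⟨ Cpow-Rrev-Cpow k v ⟩
  Rrev v                                      ∎
  where open ≡-Reasoning

Rrev-Cpow : ∀ {n} k (v : Z2^ n) → k ≤ n → Rrev (Cpow k v) ≡ Cpow (n ∸ k) (Rrev v)
Rrev-Cpow {n} k v k≤n = begin
  Rrev (Cpow k v)                          ≡⟨ sym (Cpow-order (Rrev (Cpow k v))) ⟩
  Cpow n (Rrev (Cpow k v))                 ≡⟨ cong (λ e → Cpow e (Rrev (Cpow k v))) (sym (m∸n+n≡m k≤n)) ⟩
  Cpow (n ∸ k + k) (Rrev (Cpow k v))       ≡⟨ Cpow-+ (n ∸ k) k _ ⟩
  Cpow (n ∸ k) (Cpow k (Rrev (Cpow k v)))  ≡⟨ cong (Cpow (n ∸ k)) (Cpow-Rrev-Cpow k v) ⟩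
  Cpow (n ∸ k) (Rrev v)                    ∎
  where open ≡-Reasoning

Rrev-Xvec : ∀ n → Rrev (Xvec n) ≡ Cshift (Xvec n)
Rrev-Xvec zero    = refl
Rrev-Xvec (suc n) = trans (reverse-∷ _ (replicate n false)) (cong (_∷ʳ _) (reverse-replicate n false))

module _ {n d : ℕ} .{{_ : NonZero d}} (dvd : d ∣ n) where

  private
    q : ℕ
    q = _∣_.quotient dvd

    n≡q*d : n ≡ q * d
    n≡q*d = _∣_.equality dvd

    X : Z2^ n
    X = Xvec n

    Aᵢ : ℕ → Z2^ n
    Aᵢ = A n d dvd

    G : Z2^ n → Set
    G = InG n d dvd

  InG-endomorphism : ∀ {f} → IsEndomorphism f → (∀ (i : Fin d) → G (f (Aᵢ (toℕ i)))) →
                     ∀ {x} → G x → G (f x)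
  InG-endomorphism f-endo gen g-one = subst G (sym (one-homo f-endo)) g-one
  InG-endomorphism f-endo gen (g-gen i) = gen i
  InG-endomorphism f-endo gen (g-mul {x} {y} gx gy) =
    subst G (sym (·-homo f-endo x y))
      (g-mul (InG-endomorphism f-endo gen gx) (InG-endomorphism f-endo gen gy))

  A-+d : ∀ i → Aᵢ (i + d) ≡ Aᵢ i
  A-+d i = begin
    prodA n d (i + d) q                         ≡⟨ prodA-∏ n d (i + d) q ⟩
    ∏ (λ j → Cpow (i + d + j * d) X) q          ≡⟨ ∏-cong q (λ j _ → cong (λ e → Cpow e X) (+-assoc i d (j * d))) ⟩
    ∏ (λ j → f (suc j)) q                       ≡⟨ ∏-shift-periodic f q fq≡f0 ⟩
    ∏ f q                                       ≡⟨ sym (prodA-∏ n d i q) ⟩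
    prodA n d i q                               ∎
    where
    open ≡-Reasoning
    f : ℕ → Z2^ n
    f j = Cpow (i + j * d) X
    fq≡f0 : f q ≡ f 0
    fq≡f0 = begin
      Cpow (i + q * d) X     ≡⟨ cong (λ e → Cpow (i + e) X) (sym n≡q*d) ⟩
      Cpow (i + n) X         ≡⟨ Cpow-+ i n X ⟩
      Cpow i (Cpow n X)      ≡⟨ cong (Cpow i) (Cpow-order X) ⟩
      Cpow i X               ≡⟨ cong (λ e → Cpow e X) (sym (+-identityʳ i)) ⟩
      Cpow (i + 0) X         ∎

  A-+*d : ∀ i t → Aᵢ (i + t * d) ≡ Aᵢ i
  A-+*d i zero    = cong Aᵢ (+-identityʳ i)
  A-+*d i (suc t) = begin
    Aᵢ (i + (d + t * d))   ≡⟨ cong Aᵢ (sym (+-assoc i d (t * d))) ⟩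
    Aᵢ (i + d + t * d)     ≡⟨ A-+*d (i + d) t ⟩
    Aᵢ (i + d)             ≡⟨ A-+d i ⟩
    Aᵢ i                   ∎
    where open ≡-Reasoning

  A∈G : ∀ i → G (Aᵢ i)
  A∈G i = subst G (sym Ai≡Ar) (subst (λ r → G (Aᵢ r)) (toℕ-fromℕ< r<d) (g-gen (fromℕ< r<d)))
    where
    r<d : i % d < d
    r<d = m%n<n i d
    Ai≡Ar : Aᵢ i ≡ Aᵢ (i % d)
    Ai≡Ar = trans (cong Aᵢ (m≡m%n+[m/n]*n i d)) (A-+*d (i % d) (i / d))

  Cpow-A₀ : ∀ i → Cpow i (Aᵢ 0) ≡ Aᵢ i
  Cpow-A₀ i = begin
    Cpow i (prodA n d 0 q)                    ≡⟨ cong (Cpow i) (prodA-∏ n d 0 q) ⟩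
    Cpow i (∏ (λ j → Cpow (j * d) X) q)       ≡⟨ ∏-homo (Cpow-isEndomorphism i) _ q ⟩
    ∏ (λ j → Cpow i (Cpow (j * d) X)) q       ≡⟨ ∏-cong q (λ j _ → sym (Cpow-+ i (j * d) X)) ⟩
    ∏ (λ j → Cpow (i + j * d) X) q            ≡⟨ sym (prodA-∏ n d i q) ⟩
    prodA n d i q                             ∎
    where open ≡-Reasoning

  Rrev-A₀ : Rrev (Aᵢ 0) ≡ Cshift (Aᵢ 0)
  Rrev-A₀ = begin
    Rrev (prodA n d 0 q)                                ≡⟨ cong Rrev (prodA-∏ n d 0 q) ⟩
    Rrev (∏ f q)                                        ≡⟨ ∏-homo Rrev-isEndomorphism f q ⟩
    ∏ (λ j → Rrev (f j)) q                              ≡⟨ ∏-cong q Rrev-f ⟩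
    ∏ (λ j → Cshift (f (suc (q ∸ suc j)))) q            ≡⟨ sym (∏-homo Cshift-isEndomorphism _ q) ⟩
    Cshift (∏ (λ j → f (suc (q ∸ suc j))) q)            ≡⟨ cong Cshift (sym (∏-reverse (λ j → f (suc j)) q)) ⟩
    Cshift (∏ (λ j → f (suc j)) q)                      ≡⟨ cong Cshift (∏-shift-periodic f q fq≡f0) ⟩
    Cshift (∏ f q)                                      ≡⟨ cong Cshift (sym (prodA-∏ n d 0 q)) ⟩
    Cshift (prodA n d 0 q)                              ∎
    where
    open ≡-Reasoning
    f : ℕ → Z2^ n
    f j = Cpow (j * d) X
    fq≡f0 : f q ≡ f 0
    fq≡f0 = trans (cong (λ e → Cpow e X) (sym n≡q*d)) (Cpow-order X)
    Rrev-f : ∀ j → j < q → Rrev (f j) ≡ Cshift (f (suc (q ∸ suc j)))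
    Rrev-f j j<q = begin
      Rrev (Cpow (j * d) X)                ≡⟨ Rrev-Cpow (j * d) X jd≤n ⟩
      Cpow (n ∸ j * d) (Rrev X)            ≡⟨ cong (Cpow (n ∸ j * d)) (Rrev-Xvec n) ⟩
      Cpow (n ∸ j * d) (Cshift X)          ≡⟨ sym (Cpow-suc (n ∸ j * d) X) ⟩
      Cshift (Cpow (n ∸ j * d) X)          ≡⟨ cong (λ e → Cshift (Cpow e X)) n∸jd≡[q∸j]d ⟩
      Cshift (Cpow (suc (q ∸ suc j) * d) X) ∎
      where
      jd≤n : j * d ≤ n
      jd≤n = subst (j * d ≤_) (sym n≡q*d) (*-monoˡ-≤ d (<⇒≤ j<q))
      n∸jd≡[q∸j]d : n ∸ j * d ≡ suc (q ∸ suc j) * d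
      n∸jd≡[q∸j]d = begin
        n ∸ j * d              ≡⟨ cong (_∸ j * d) n≡q*d ⟩
        q * d ∸ j * d          ≡⟨ sym (*-distribʳ-∸ d q j) ⟩
        (q ∸ j) * d            ≡⟨ cong (_* d) (+-∸-assoc 1 j<q) ⟩
        suc (q ∸ suc j) * d    ∎

  InG-Cshift : ∀ {x} → G x → G (Cshift x)
  InG-Cshift = InG-endomorphism Cshift-isEndomorphism
    (λ i → subst G (sym (Cshift-A (toℕ i))) (A∈G (suc (toℕ i))))
    where
    Cshift-A : ∀ i → Cshift (Aᵢ i) ≡ Aᵢ (suc i)
    Cshift-A i = trans (cong Cshift (sym (Cpow-A₀ i))) (Cpow-A₀ (suc i))

  InG-Cpow : ∀ k {x} → G x → G (Cpow k x)
  InG-Cpow zero    gx = gx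
  InG-Cpow (suc k) gx = InG-Cshift (InG-Cpow k gx)

  InG-Cinv : ∀ {x} → G x → G (Cinv x)
  InG-Cinv {x} gx = subst G (sym (Cinv≡Cpow x)) (InG-Cpow (pred n) gx)

  InG-Rrev : .{{_ : NonZero n}} → ∀ {x} → G x → G (Rrev x)
  InG-Rrev = InG-endomorphism Rrev-isEndomorphism λ i →
    subst G (sym (Rrev-Aᵢ (toℕ i) (≤-trans (<⇒≤ (toℕ<n i)) (∣⇒≤ dvd))))
      (InG-Cpow (n ∸ toℕ i) (InG-Cshift (A∈G 0)))
    where
    Rrev-Aᵢ : ∀ i → i ≤ n → Rrev (Aᵢ i) ≡ Cpow (n ∸ i) (Cshift (Aᵢ 0))
    Rrev-Aᵢ i i≤n = begin
      Rrev (Aᵢ i)                     ≡⟨ cong Rrev (sym (Cpow-A₀ i)) ⟩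
      Rrev (Cpow i (Aᵢ 0))            ≡⟨ Rrev-Cpow i (Aᵢ 0) i≤n ⟩
      Cpow (n ∸ i) (Rrev (Aᵢ 0))      ≡⟨ cong (Cpow (n ∸ i)) Rrev-A₀ ⟩
      Cpow (n ∸ i) (Cshift (Aᵢ 0))    ∎
      where open ≡-Reasoning

  InG-act : .{{_ : NonZero n}} → ∀ w {x} → G x → G (act w x)
  InG-act List.[]            gx = gx
  InG-act (genR List.∷ w)    gx = InG-Rrev (InG-act w gx)
  InG-act (genC List.∷ w)    gx = InG-Cshift (InG-act w gx)
  InG-act (genC⁻¹ List.∷ w)  gx = InG-Cinv (InG-act w gx)

mainTheorem17 : (n d : ℕ) → 1 ≤ n → 1 ≤ d → (dvd : d ∣ n) →
    ∀ x y → InG n d dvd x → SameOrbit x y → InG n d dvd y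
mainTheorem17 n d 1≤n 1≤d dvd x y gx (w , refl) =
  InG-act {{>-nonZero 1≤d}} dvd {{>-nonZero 1≤n}} w gx
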